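{- Let $d\ge 3$ be an integer, $k$ a sufficiently large positive integer, $s=16k^{2d}$, $m=s^k$, and $N=m^{d-1}|T_k|$. Let $Q\subset[0,m)^d$ be a set of $N$ points such that every block of $\mathcal{B}^-$ contains at most one point of $Q$ and the number of triples of points of $Q$ contained in a common block of $\mathcal{B}$ is at most $32|T_k|^3N$. Let $G$ be the graph on vertex set $Q$ in which two distinct points are adjacent iff they lie in a common block $B\in\mathcal{B}$. Then for every real $\lambda\geq 2$ and every $C\subset Q$ with $|C|\geq\lambda m^{d-1}$, the maximum degree of the induced subgraph $G[C]$ is at least $\frac{\lambda}{2}|T_k|$.
   Context: $\mathbb{N}=\{0,1,2,\dots\}$. For $\mathbf{t}\in\mathbb{N}^d$ and $\mathbf{p}\in\mathbb{Z}^d$, the $\mathbf{t}$-block $B_{\mathbf{t}}(\mathbf{p})$ is the half-open box $\prod_{i=1}^d\left[s^{\mathbf{t}(i)}\mathbf{p}(i),\ s^{\mathbf{t}(i)}\mathbf{p}(i)+s^{\mathbf{t}(i)}\right)$. For $\ell\in\mathbb{N}$, $T_\ell=\{\mathbf{t}\in\mathbb{N}^d:\sum_i\mathbf{t}(i)=\ell\}$, so $|T_\ell|=\binom{\ell+d-1}{d-1}$. $\mathcal{B}$ is the family of all $\mathbf{t}$-blocks with $\mathbf{t}\in T_k$ contained in $[0,m]^d$, and $\mathcal{B}^-$ the family of all $\mathbf{t}$-blocks with $\mathbf{t}\in T_{k-1}$ contained in $[0,m]^d$.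
   Formalization: The points of Q have rational coordinates, and the parameter λ is rational rather than real. -}

module Defs where

open import Data.Nat as ℕ using (ℕ; zero; suc; _^_)
open import Data.Nat.Combinatorics using (_C_)
open import Data.Integer as ℤ using (ℤ; +_)
open import Data.Rational as ℚ using (ℚ; _/_)
open import Data.Fin using (Fin)
import Data.Fin
open import Data.Vec using (Vec; lookup; sum)
open import Data.Product using (Σ; _×_; ∃; ∃-syntax; _,_)
open import Relation.Binary.PropositionalEquality using (_≡_)

ℕ→ℚ : ℕ → ℚ
ℕ→ℚ n = + n / 1

ℤ→ℚ : ℤ → ℚ
ℤ→ℚ z = z / 1

-- points of ℚ^d (reals are unavailable)
Point : ℕ → Set
Point d = Vec ℚ d

Tsize : ℕ → ℕ → ℕ
Tsize d ℓ = (ℓ ℕ.+ d ℕ.∸ 1) C (d ℕ.∸ 1)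

InBlock : ∀ {d} → ℕ → Vec ℕ d → Vec ℤ d → Point d → Set
InBlock {d} s t p x = ∀ (i : Fin d) →
  (ℤ→ℚ (+ (s ^ lookup t i) ℤ.* lookup p i) ℚ.≤ lookup x i)
  × (lookup x i ℚ.< ℤ→ℚ (+ (s ^ lookup t i) ℤ.* lookup p i ℤ.+ + (s ^ lookup t i)))

BlockInCube : ∀ {d} → ℕ → ℕ → Vec ℕ d → Vec ℤ d → Set
BlockInCube {d} s m t p = ∀ (i : Fin d) →
  (+ 0 ℤ.≤ + (s ^ lookup t i) ℤ.* lookup p i)
  × (+ (s ^ lookup t i) ℤ.* lookup p i ℤ.+ + (s ^ lookup t i) ℤ.≤ + m)

-- a block of the family of all t-blocks with t ∈ T_ℓ contained in [0,m]^d
-- (ℓ = k gives 𝓑, ℓ = k-1 gives 𝓑⁻)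
record Block (d s m ℓ : ℕ) : Set where
  constructor block
  field
    t      : Vec ℕ d
    p      : Vec ℤ d
    t∈T    : sum t ≡ ℓ
    inCube : BlockInCube s m t p

InB : ∀ {d s m ℓ} → Block d s m ℓ → Point d → Set
InB {s = s} B x = InBlock s (Block.t B) (Block.p B) x

InHalfOpenCube : ∀ {d} → ℕ → Point d → Set
InHalfOpenCube {d} m x = ∀ (i : Fin d) → (ℚ.0ℚ ℚ.≤ lookup x i) × (lookup x i ℚ.< ℕ→ℚ m)

sPar : ℕ → ℕ → ℕ
sPar d k = 16 ℕ.* k ^ (2 ℕ.* d)

mPar : ℕ → ℕ → ℕ
mPar d k = sPar d k ^ k

NPar : ℕ → ℕ → ℕ
NPar d k = mPar d k ^ (d ℕ.∸ 1) ℕ.* Tsize d k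

CommonBlock2 : (d k : ℕ) → Point d → Point d → Set
CommonBlock2 d k x y = Σ (Block d (sPar d k) (mPar d k) k) λ B → InB B x × InB B y

CommonBlock3 : (d k : ℕ) → Point d → Point d → Point d → Set
CommonBlock3 d k x y z = Σ (Block d (sPar d k) (mPar d k) k) λ B → InB B x × InB B y × InB B z

-- an (unordered) triple of points of Q lying in a common block of 𝓑,
-- encoded by strictly increasing indices a < b < c
GoodTriple : (d k : ℕ) → (Fin (NPar d k) → Point d) →
             Fin (NPar d k) × Fin (NPar d k) × Fin (NPar d k) → Set
GoodTriple d k Q (a , b , c) = (a Data.Fin.< b) × (b Data.Fin.< c) × CommonBlock3 d k (Q a) (Q b) (Q c)

{-# OPTIONS --safe #-}
module Submission where

-- For each shape t ∈ T_k the t-blocks tile [0,m)^d into M = m^(d-1) blocks, so by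
-- Cauchy–Schwarz the sizes |B ∩ C| of the t-blocks B containing the points of C add up to at
-- least |C|²/M. Summing over the |T_k| shapes and averaging over C yields v ∈ C whose blocks of
-- the various shapes hold, together, at least |T_k||C|/M ≥ λ|T_k| points of C. Distinct shapes
-- t ≠ t' cannot both put the same w ≠ v in a block with v: some u ∈ T_(k-1) is, axis by axis,
-- coarser than t or than t', so v and w would share a block of 𝓑⁻. Hence v has at least
-- λ|T_k| − |T_k| ≥ (λ/2)|T_k| distinct neighbours in G[C].

open import Defs
open import Data.Nat as ℕ using (ℕ; zero; suc; _+_; _*_; _∸_; _^_; _≤_; _<_; z≤n; s≤s; NonZero)
open import Data.Nat.Properties
open import Data.Nat.DivMod
  using (_/_; _%_; m/n*n≤m; m≡m%n+[m/n]*n; m%n<n; m<n*o⇒m/o<n; m/n/o≡m/[n*o]; /-congˡ; /-congʳ)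
open import Data.Nat.Coprimality using (1-coprimeTo) renaming (sym to coprime-sym)
open import Data.Nat.ListAction using (sum)
open import Data.Nat.Tactic.RingSolver using (solve-∀)
open import Algebra.Properties.CommutativeSemigroup +-commutativeSemigroup using (interchange; x∙yz≈y∙xz)
open import Data.Integer as ℤ using (ℤ; +_; -[1+_])
import Data.Integer.Properties as ℤ
open import Data.Rational as ℚ using (ℚ; mkℚ; ½; 0ℚ; *≤*; *<*)
import Data.Rational.Properties as ℚ
open import Data.Fin as F using (Fin; zero; suc)
open import Data.Vec as Vec using (Vec; []; _∷_; lookup; replicate; tabulate)
open import Data.Vec.Properties using (≡-dec; ∷-injectiveʳ; lookup∘tabulate; lookup-map)
open import Data.List
  using (List; []; _∷_; [_]; length; map; filter; _++_; concatMap; upTo; cartesianProductWith)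
open import Data.List.Properties using (length-map; length-++; length-upTo; filter-all; filter-reject)
open import Data.List.Extrema.Nat using (argmax; argmax-all; f[⊥]≤f[argmax]; f[xs]≤f[argmax])
open import Data.List.Membership.Propositional using (_∈_; find)
open import Data.List.Membership.Propositional.Properties using (∈-filter⁻; ∈-map⁻; ∈-++⁻; ∈-upTo⁺)
open import Data.List.Relation.Unary.Any using (here; there)
import Data.List.Relation.Unary.Any.Properties as Any
open import Data.List.Relation.Unary.All as All using (All; []; _∷_)
open import Data.List.Relation.Unary.AllPairs using ([]; _∷_)
open import Data.List.Relation.Unary.Unique.Propositional using (Unique)
import Data.List.Relation.Unary.Unique.Propositional.Properties as Unique
open import Data.List.Relation.Binary.Disjoint.Propositional using (Disjoint)
open import Data.Product using (Σ; _×_; ∃-syntax; _,_; proj₁; proj₂)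
open import Data.Sum using (_⊎_; inj₁; inj₂)
open import Data.Empty using (⊥-elim)
open import Function using (_∘_)
open import Level using (0ℓ)
open import Relation.Nullary using (¬_; Dec; yes; no; ¬?)
open import Relation.Unary using (Pred; Decidable)
open import Relation.Unary.Properties using (∁?)
open import Relation.Binary.Definitions using (DecidableEquality)
open import Relation.Binary.PropositionalEquality hiding ([_])

ℕ→ℚ≡mkℚ : ∀ n → ℕ→ℚ n ≡ mkℚ (+ n) 0 (coprime-sym (1-coprimeTo n))
ℕ→ℚ≡mkℚ n = ℚ.normalize-coprime _

ℕ→ℚ-mono-≤ : ∀ {m n} → m ≤ n → ℕ→ℚ m ℚ.≤ ℕ→ℚ n
ℕ→ℚ-mono-≤ {m} {n} m≤n rewrite ℕ→ℚ≡mkℚ m | ℕ→ℚ≡mkℚ n =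
  *≤* (subst₂ ℤ._≤_ (sym (ℤ.*-identityʳ (+ m))) (sym (ℤ.*-identityʳ (+ n))) (ℤ.+≤+ m≤n))

ℕ→ℚ-cancel-≤ : ∀ {m n} → ℕ→ℚ m ℚ.≤ ℕ→ℚ n → m ≤ n
ℕ→ℚ-cancel-≤ {m} {n} m≤n rewrite ℕ→ℚ≡mkℚ m | ℕ→ℚ≡mkℚ n
  with *≤* h ← m≤n
  rewrite ℤ.*-identityʳ (+ m) | ℤ.*-identityʳ (+ n) = ℤ.drop‿+≤+ h

ℕ→ℚ-cancel-< : ∀ {m n} → ℕ→ℚ m ℚ.< ℕ→ℚ n → m < n
ℕ→ℚ-cancel-< m<n = ≰⇒> (λ n≤m → ℚ.<-irrefl refl (ℚ.<-≤-trans m<n (ℕ→ℚ-mono-≤ n≤m)))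

ℕ→ℚ-homo-+ : ∀ m n → ℕ→ℚ (m + n) ≡ ℕ→ℚ m ℚ.+ ℕ→ℚ n
ℕ→ℚ-homo-+ m n rewrite ℕ→ℚ≡mkℚ m | ℕ→ℚ≡mkℚ n =
  ℚ./-cong (trans (ℤ.pos-+ m n) (sym (cong₂ ℤ._+_ (ℤ.*-identityʳ (+ m)) (ℤ.*-identityʳ (+ n))))) refl

ℕ→ℚ-homo-* : ∀ m n → ℕ→ℚ (m * n) ≡ ℕ→ℚ m ℚ.* ℕ→ℚ n
ℕ→ℚ-homo-* m n rewrite ℕ→ℚ≡mkℚ m | ℕ→ℚ≡mkℚ n = ℚ./-cong (ℤ.pos-* m n) refl

m<[1+m/n]*n : ∀ m n .{{_ : NonZero n}} → m < suc (m / n) * n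
m<[1+m/n]*n m n = begin-strict
  m                   ≡⟨ m≡m%n+[m/n]*n m n ⟩
  m % n + m / n * n   <⟨ +-monoˡ-< (m / n * n) (m%n<n m n) ⟩
  suc (m / n) * n     ∎
  where open ≤-Reasoning

-- Junk on negative x (it returns ⌊ ∣x∣ ⌋); every lemma about it assumes 0 ≤ x.
⌊_⌋ℕ : ℚ → ℕ
⌊ mkℚ n d-1 _ ⌋ℕ = ℤ.∣ n ∣ / suc d-1

⌊x⌋≤x : ∀ {x} → 0ℚ ℚ.≤ x → ℕ→ℚ ⌊ x ⌋ℕ ℚ.≤ x
⌊x⌋≤x {mkℚ (+ a) d-1 _} _ rewrite ℕ→ℚ≡mkℚ (a / suc d-1) =
  *≤* (subst₂ ℤ._≤_ (ℤ.pos-* (a / suc d-1) (suc d-1)) (sym (ℤ.*-identityʳ (+ a)))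
        (ℤ.+≤+ (m/n*n≤m a (suc d-1))))
⌊x⌋≤x {mkℚ -[1+ _ ] _ _} (*≤* ())

x<⌊x⌋+1 : ∀ {x} → 0ℚ ℚ.≤ x → x ℚ.< ℕ→ℚ (suc ⌊ x ⌋ℕ)
x<⌊x⌋+1 {mkℚ (+ a) d-1 _} _ rewrite ℕ→ℚ≡mkℚ (suc (a / suc d-1)) =
  *<* (subst₂ ℤ._<_ (sym (ℤ.*-identityʳ (+ a))) (ℤ.pos-* (suc (a / suc d-1)) (suc d-1))
        (ℤ.+<+ (m<[1+m/n]*n a (suc d-1))))
x<⌊x⌋+1 {mkℚ -[1+ _ ] _ _} (*≤* ())

ℚ-+-cancelʳ-≤ : ∀ {p q} r → p ℚ.+ r ℚ.≤ q ℚ.+ r → p ℚ.≤ q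
ℚ-+-cancelʳ-≤ {p} {q} r p+r≤q+r = subst₂ ℚ._≤_ (+-cancel p) (+-cancel q) (ℚ.+-monoˡ-≤ (ℚ.- r) p+r≤q+r)
  where
  +-cancel : ∀ x → x ℚ.+ r ℚ.- r ≡ x
  +-cancel x = trans (ℚ.+-assoc x r (ℚ.- r)) (trans (cong (x ℚ.+_) (ℚ.+-inverseʳ r)) (ℚ.+-identityʳ x))

λt≤D+t⇒λ/2·t≤D : ∀ {lam} t D → ℕ→ℚ 2 ℚ.≤ lam → lam ℚ.* ℕ→ℚ t ℚ.≤ ℕ→ℚ D ℚ.+ ℕ→ℚ t →
                  (lam ℚ.* ½) ℚ.* ℕ→ℚ t ℚ.≤ ℕ→ℚ D
λt≤D+t⇒λ/2·t≤D {lam} t D 2≤lam λt≤D+t = ℚ-+-cancelʳ-≤ y (begin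
  y ℚ.+ y          ≡⟨ y+y≡λt ⟩
  lam ℚ.* ℕ→ℚ t    ≤⟨ λt≤D+t ⟩
  ℕ→ℚ D ℚ.+ ℕ→ℚ t  ≤⟨ ℚ.+-monoʳ-≤ (ℕ→ℚ D) t≤y ⟩
  ℕ→ℚ D ℚ.+ y      ∎)
  where
  open ℚ.≤-Reasoning
  instance _ = ℚ.normalize-nonNeg t 1
  y = (lam ℚ.* ½) ℚ.* ℕ→ℚ t
  y+y≡λt : y ℚ.+ y ≡ lam ℚ.* ℕ→ℚ t
  y+y≡λt = trans (sym (ℚ.*-distribʳ-+ (ℕ→ℚ t) (lam ℚ.* ½) (lam ℚ.* ½)))
                 (cong (ℚ._* ℕ→ℚ t) (trans (sym (ℚ.*-distribˡ-+ lam ½ ½)) (ℚ.*-identityʳ lam)))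
  t≤y : ℕ→ℚ t ℚ.≤ y
  t≤y = subst (ℚ._≤ y) (ℚ.*-identityˡ (ℕ→ℚ t))
          (ℚ.*-monoʳ-≤-nonNeg (ℕ→ℚ t) (ℚ.*-monoʳ-≤-nonNeg ½ 2≤lam))

λM≤c⇒λt≤D+t : ∀ lam M c t D .{{_ : NonZero M}} → lam ℚ.* ℕ→ℚ M ℚ.≤ ℕ→ℚ c →
               t * c ≤ M * (D + t) → lam ℚ.* ℕ→ℚ t ℚ.≤ ℕ→ℚ D ℚ.+ ℕ→ℚ t
λM≤c⇒λt≤D+t lam M c t D λM≤c tc≤M[D+t] = ℚ.*-cancelˡ-≤-pos (ℕ→ℚ M) (begin
  ℕ→ℚ M ℚ.* (lam ℚ.* ℕ→ℚ t)
    ≡⟨ trans (sym (ℚ.*-assoc (ℕ→ℚ M) lam (ℕ→ℚ t))) (cong (ℚ._* ℕ→ℚ t) (ℚ.*-comm (ℕ→ℚ M) lam)) ⟩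
  (lam ℚ.* ℕ→ℚ M) ℚ.* ℕ→ℚ t    ≤⟨ ℚ.*-monoʳ-≤-nonNeg (ℕ→ℚ t) λM≤c ⟩
  ℕ→ℚ c ℚ.* ℕ→ℚ t              ≡⟨ trans (sym (ℕ→ℚ-homo-* c t)) (cong ℕ→ℚ (*-comm c t)) ⟩
  ℕ→ℚ (t * c)                  ≤⟨ ℕ→ℚ-mono-≤ tc≤M[D+t] ⟩
  ℕ→ℚ (M * (D + t))            ≡⟨ trans (ℕ→ℚ-homo-* M (D + t)) (cong (ℕ→ℚ M ℚ.*_) (ℕ→ℚ-homo-+ D t)) ⟩
  ℕ→ℚ M ℚ.* (ℕ→ℚ D ℚ.+ ℕ→ℚ t)  ∎)
  where
  open ℚ.≤-Reasoning
  instance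
    _ = ℚ.normalize-nonNeg t 1
    _ = ℚ.normalize-pos M 1

∑ : {A : Set} → List A → (A → ℕ) → ℕ
∑ xs f = sum (map f xs)

infix 5 ∑
syntax ∑ xs (λ x → e) = ∑[ x ∈ xs ] e

module _ {A : Set} where

  ∑-cong : ∀ (xs : List A) {f g : A → ℕ} → (∀ {x} → x ∈ xs → f x ≡ g x) → ∑ xs f ≡ ∑ xs g
  ∑-cong []       f≡g = refl
  ∑-cong (x ∷ xs) f≡g = cong₂ _+_ (f≡g (here refl)) (∑-cong xs (f≡g ∘ there))

  ∑-mono-≤ : ∀ (xs : List A) {f g : A → ℕ} → (∀ {x} → x ∈ xs → f x ≤ g x) → ∑ xs f ≤ ∑ xs g
  ∑-mono-≤ []       f≤g = z≤n
  ∑-mono-≤ (x ∷ xs) f≤g = +-mono-≤ (f≤g (here refl)) (∑-mono-≤ xs (λ x∈xs → f≤g (there x∈xs)))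

  ∑-const : ∀ (xs : List A) c → ∑[ _ ∈ xs ] c ≡ length xs * c
  ∑-const []       c = refl
  ∑-const (x ∷ xs) c = cong (_+_ c) (∑-const xs c)

  ∑-distrib-+ : ∀ (xs : List A) (f g : A → ℕ) → ∑[ x ∈ xs ] (f x + g x) ≡ ∑ xs f + ∑ xs g
  ∑-distrib-+ []       f g = refl
  ∑-distrib-+ (x ∷ xs) f g = trans (cong (_+_ (f x + g x)) (∑-distrib-+ xs f g)) (interchange (f x) (g x) _ _)

  *-distribˡ-∑ : ∀ c (xs : List A) (f : A → ℕ) → c * ∑ xs f ≡ ∑[ x ∈ xs ] c * f x
  *-distribˡ-∑ c []       f = *-zeroʳ c
  *-distribˡ-∑ c (x ∷ xs) f = trans (*-distribˡ-+ c (f x) _) (cong (_+_ (c * f x)) (*-distribˡ-∑ c xs f))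

  ∑-comm : ∀ {B : Set} (xs : List A) (ys : List B) (h : A → B → ℕ) →
           ∑[ x ∈ xs ] ∑[ y ∈ ys ] h x y ≡ ∑[ y ∈ ys ] ∑[ x ∈ xs ] h x y
  ∑-comm xs []       h = trans (∑-const xs 0) (*-zeroʳ (length xs))
  ∑-comm xs (y ∷ ys) h =
    trans (∑-distrib-+ xs (λ x → h x y) _) (cong (_+_ (∑ xs (λ x → h x y))) (∑-comm xs ys h))

  ∃-≥-average : ∀ (xs : List A) (f : A → ℕ) → 0 < length xs → ∃[ v ] v ∈ xs × ∑ xs f ≤ length xs * f v
  ∃-≥-average (x ∷ xs) f _ = v , v∈x∷xs , (begin
    ∑ (x ∷ xs) f         ≤⟨ ∑-mono-≤ (x ∷ xs) (All.lookup f≤fv) ⟩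
    ∑[ _ ∈ x ∷ xs ] f v  ≡⟨ ∑-const (x ∷ xs) (f v) ⟩
    length (x ∷ xs) * f v ∎)
    where
    open ≤-Reasoning
    v = argmax f x xs
    v∈x∷xs : v ∈ x ∷ xs
    v∈x∷xs = argmax-all f {P = _∈ x ∷ xs} (here refl) (All.tabulate there)
    f≤fv : All (λ y → f y ≤ f v) (x ∷ xs)
    f≤fv = f[⊥]≤f[argmax] {f = f} x xs ∷ f[xs]≤f[argmax] {f = f} x xs

  module _ {P : Pred A 0ℓ} (P? : Decidable P) where

    ∑-partition : ∀ (xs : List A) (f : A → ℕ) → ∑ xs f ≡ ∑ (filter P? xs) f + ∑ (filter (∁? P?) xs) f
    ∑-partition []       f = refl
    ∑-partition (x ∷ xs) f with P? x
    ... | yes _ = trans (cong (_+_ (f x)) (∑-partition xs f)) (sym (+-assoc (f x) _ _))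
    ... | no  _ = trans (cong (_+_ (f x)) (∑-partition xs f)) (x∙yz≈y∙xz (f x) (∑ (filter P? xs) f) _)

    length-partition : ∀ (xs : List A) → length xs ≡ length (filter P? xs) + length (filter (∁? P?) xs)
    length-partition xs = begin
      length xs                   ≡⟨ sym (length≡∑1 xs) ⟩
      ∑[ _ ∈ xs ] 1               ≡⟨ ∑-partition xs (λ _ → 1) ⟩
      (∑[ _ ∈ filter P? xs ] 1) + (∑[ _ ∈ filter (∁? P?) xs ] 1)
        ≡⟨ cong₂ _+_ (length≡∑1 (filter P? xs)) (length≡∑1 (filter (∁? P?) xs)) ⟩
      length (filter P? xs) + length (filter (∁? P?) xs) ∎
      where
      open ≡-Reasoning
      length≡∑1 : ∀ ys → ∑[ _ ∈ ys ] 1 ≡ length ys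
      length≡∑1 ys = trans (∑-const ys 1) (*-identityʳ (length ys))

    filter-⊆∁ : ∀ {Q : Pred A 0ℓ} (Q? : Decidable Q) → (∀ {x} → P x → ¬ Q x) →
                ∀ xs → filter P? xs ≡ filter P? (filter (∁? Q?) xs)
    filter-⊆∁ Q? P⇒¬Q []       = refl
    filter-⊆∁ Q? P⇒¬Q (x ∷ xs) with Q? x
    ... | yes q = trans (filter-reject P? (λ p → P⇒¬Q p q)) (filter-⊆∁ Q? P⇒¬Q xs)
    ... | no  _ with P? x
    ...   | yes _ = cong (x ∷_) (filter-⊆∁ Q? P⇒¬Q xs)
    ...   | no  _ = filter-⊆∁ Q? P⇒¬Q xs

2xy≤x²+y² : ∀ x y → 2 * x * y ≤ x * x + y * y
2xy≤x²+y² zero    y       = z≤n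
2xy≤x²+y² (suc x) zero    = ≤-trans (≤-reflexive (*-zeroʳ (2 * suc x))) z≤n
2xy≤x²+y² (suc x) (suc y) = begin
  2 * (1 + x) * (1 + y)                  ≡⟨ expand x y ⟩
  2 * x * y + 2 * (1 + x + y)            ≤⟨ +-monoˡ-≤ _ (2xy≤x²+y² x y) ⟩
  x * x + y * y + 2 * (1 + x + y)        ≡⟨ collect x y ⟩
  (1 + x) * (1 + x) + (1 + y) * (1 + y)  ∎
  where
  open ≤-Reasoning
  expand : ∀ x y → 2 * (1 + x) * (1 + y) ≡ 2 * x * y + 2 * (1 + x + y)
  expand = solve-∀
  collect : ∀ x y → x * x + y * y + 2 * (1 + x + y) ≡ (1 + x) * (1 + x) + (1 + y) * (1 + y)
  collect = solve-∀

-- Inductive step of Cauchy–Schwarz (Σᵢ nᵢ)² ≤ L · Σᵢ nᵢ² over L numbers, with b = Σᵢ nᵢ, S = Σᵢ nᵢ²,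
-- when one more number a is added.
[a+b]²≤[1+L][a²+S] : ∀ a b L S → b * b ≤ L * S → (a + b) * (a + b) ≤ suc L * (a * a + S)
[a+b]²≤[1+L][a²+S] a zero    L       S _ = begin
  (a + 0) * (a + 0)     ≡⟨ cong (λ z → z * z) (+-identityʳ a) ⟩
  a * a                 ≤⟨ m≤m+n (a * a) S ⟩
  a * a + S             ≤⟨ m≤m+n (a * a + S) _ ⟩
  suc L * (a * a + S)   ∎
  where open ≤-Reasoning
[a+b]²≤[1+L][a²+S] a (suc b) (suc L) S b²≤LS = *-cancelˡ-≤ (suc L) (begin
  L' * ((a + B) * (a + B))                                         ≡⟨ expand L' a B ⟩
  L' * (a * a) + 2 * (L' * a) * B + L' * (B * B)
    ≤⟨ +-mono-≤ (+-monoʳ-≤ (L' * (a * a)) (2xy≤x²+y² (L' * a) B)) (*-monoʳ-≤ L' b²≤LS) ⟩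
  L' * (a * a) + ((L' * a) * (L' * a) + B * B) + L' * (L' * S)
    ≤⟨ +-monoˡ-≤ _ (+-monoʳ-≤ (L' * (a * a)) (+-monoʳ-≤ _ b²≤LS)) ⟩
  L' * (a * a) + ((L' * a) * (L' * a) + L' * S) + L' * (L' * S)  ≡⟨ collect L' a S ⟩
  L' * (suc L' * (a * a + S))                                      ∎)
  where
  open ≤-Reasoning
  L' = suc L
  B = suc b
  expand : ∀ L a B → L * ((a + B) * (a + B)) ≡ L * (a * a) + 2 * (L * a) * B + L * (B * B)
  expand = solve-∀
  collect : ∀ L a S → L * (a * a) + ((L * a) * (L * a) + L * S) + L * (L * S) ≡ L * (suc L * (a * a + S))
  collect = solve-∀

length≤1+length-filter-≢ : ∀ {A : Set} (_≟_ : DecidableEquality A) v {xs : List A} → Unique xs →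
                           length xs ≤ suc (length (filter (λ w → ¬? (w ≟ v)) xs))
length≤1+length-filter-≢ _≟_ v {[]}     _                   = z≤n
length≤1+length-filter-≢ _≟_ v {x ∷ xs} (x∉xs ∷ xs-unique) with x ≟ v
... | yes refl = s≤s (≤-reflexive (cong length (sym (filter-all (λ w → ¬? (w ≟ x)) (All.map ≢-sym x∉xs)))))
... | no  _    = s≤s (length≤1+length-filter-≢ _≟_ v xs-unique)

module _ {A K : Set} (_≟_ : DecidableEquality K) (f : A → K) where

  fiberSize : List A → K → ℕ
  fiberSize C κ = length (filter (λ w → f w ≟ κ) C)

  -- Cauchy–Schwarz over the fibers of f: the sum below is the sum of the squared fiber sizes.
  length²≤length*∑fiberSize : ∀ (Ks : List K) (C : List A) → (∀ {v} → v ∈ C → f v ∈ Ks) →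
                             length C * length C ≤ length Ks * (∑[ v ∈ C ] fiberSize C (f v))
  length²≤length*∑fiberSize []       []      _       = z≤n
  length²≤length*∑fiberSize []       (v ∷ C) f[C]⊆[] with () ← f[C]⊆[] (here refl)
  length²≤length*∑fiberSize (κ ∷ Ks) C       f[C]⊆κ∷Ks =
    subst₂ _≤_ (cong (λ n → n * n) (sym (length-partition at-κ? C)))
               (cong (suc (length Ks) *_) (sym ∑fiberSize≡))
      ([a+b]²≤[1+L][a²+S] (length C₁) (length C₂) (length Ks) _
        (length²≤length*∑fiberSize Ks C₂ f[C₂]⊆Ks))
    where
    at-κ? = λ w → f w ≟ κ
    C₁ = filter at-κ? C
    C₂ = filter (∁? at-κ?) C
    f[C₂]⊆Ks : ∀ {v} → v ∈ C₂ → f v ∈ Ks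
    f[C₂]⊆Ks v∈C₂ with v∈C , fv≢κ ← ∈-filter⁻ (∁? at-κ?) {xs = C} v∈C₂ with f[C]⊆κ∷Ks v∈C
    ... | here fv≡κ = ⊥-elim (fv≢κ fv≡κ)
    ... | there fv∈Ks = fv∈Ks
    fiberSize-C₁ : ∀ {v} → v ∈ C₁ → fiberSize C (f v) ≡ length C₁
    fiberSize-C₁ v∈C₁ = cong (fiberSize C) (proj₂ (∈-filter⁻ at-κ? {xs = C} v∈C₁))
    fiberSize-C₂ : ∀ {v} → v ∈ C₂ → fiberSize C (f v) ≡ fiberSize C₂ (f v)
    fiberSize-C₂ {v} v∈C₂ = cong length (filter-⊆∁ (λ w → f w ≟ f v) at-κ?
      (λ fw≡fv fw≡κ → proj₂ (∈-filter⁻ (∁? at-κ?) {xs = C} v∈C₂) (trans (sym fw≡fv) fw≡κ)) C)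
    ∑fiberSize≡ : ∑[ v ∈ C ] fiberSize C (f v) ≡ length C₁ * length C₁ + (∑[ v ∈ C₂ ] fiberSize C₂ (f v))
    ∑fiberSize≡ = begin
      ∑[ v ∈ C ] fiberSize C (f v)
        ≡⟨ ∑-partition at-κ? C _ ⟩
      (∑[ v ∈ C₁ ] fiberSize C (f v)) + (∑[ v ∈ C₂ ] fiberSize C (f v))
        ≡⟨ cong₂ _+_ (∑-cong C₁ fiberSize-C₁) (∑-cong C₂ fiberSize-C₂) ⟩
      (∑[ _ ∈ C₁ ] length C₁) + (∑[ v ∈ C₂ ] fiberSize C₂ (f v))
        ≡⟨ cong (_+ (∑[ v ∈ C₂ ] fiberSize C₂ (f v))) (∑-const C₁ (length C₁)) ⟩
      length C₁ * length C₁ + (∑[ v ∈ C₂ ] fiberSize C₂ (f v))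
        ∎
      where open ≡-Reasoning

module _ {A B : Set} (f : A → List B) where

  length-concatMap : ∀ xs → length (concatMap f xs) ≡ ∑[ x ∈ xs ] length (f x)
  length-concatMap []       = refl
  length-concatMap (x ∷ xs) = trans (length-++ (f x)) (cong (_+_ (length (f x))) (length-concatMap xs))

  ∈-concatMap⁻ : ∀ {xs v} → v ∈ concatMap f xs → ∃[ x ] x ∈ xs × v ∈ f x
  ∈-concatMap⁻ = find ∘ Any.concatMap⁻ f

  concatMap⁺-Unique : ∀ {P : Pred A 0ℓ} {xs} → Unique xs → All P xs → (∀ x → Unique (f x)) →
                      (∀ {x y} → P x → P y → x ≢ y → Disjoint (f x) (f y)) → Unique (concatMap f xs)
  concatMap⁺-Unique {xs = []}     _                 _          _        _        = []
  concatMap⁺-Unique {xs = x ∷ xs} (x∉xs ∷ xs-uniq) (px ∷ pxs) f-unique disjoint =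
    Unique.++⁺ (f-unique x) (concatMap⁺-Unique xs-uniq pxs f-unique disjoint) disjoint-x
    where
    disjoint-x : Disjoint (f x) (concatMap f xs)
    disjoint-x (v∈fx , v∈rest) with y , y∈xs , v∈fy ← ∈-concatMap⁻ v∈rest =
      disjoint px (All.lookup pxs y∈xs) (All.lookup x∉xs y∈xs) (v∈fx , v∈fy)

lookup≤sum : ∀ {n} (t : Vec ℕ n) i → lookup t i ≤ Vec.sum t
lookup≤sum (a ∷ t) zero    = m≤m+n a (Vec.sum t)
lookup≤sum (a ∷ t) (suc i) = ≤-trans (lookup≤sum t i) (m≤n+m (Vec.sum t) a)

sum[k∸t]+sum[t]≡n*k : ∀ {n} k (t : Vec ℕ n) → Vec.sum t ≤ k →
                      Vec.sum (Vec.map (k ∸_) t) + Vec.sum t ≡ n * k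
sum[k∸t]+sum[t]≡n*k k []      _     = refl
sum[k∸t]+sum[t]≡n*k {suc n} k (a ∷ t) a+t≤k = begin
  (k ∸ a + Vec.sum (Vec.map (k ∸_) t)) + (a + Vec.sum t)
    ≡⟨ interchange (k ∸ a) _ a _ ⟩
  (k ∸ a + a) + (Vec.sum (Vec.map (k ∸_) t) + Vec.sum t)
    ≡⟨ cong₂ _+_ (m∸n+n≡m (m+n≤o⇒m≤o a a+t≤k)) (sum[k∸t]+sum[t]≡n*k k t (m+n≤o⇒n≤o a a+t≤k)) ⟩
  k + n * k
    ∎
  where open ≡-Reasoning

∃-pred-sum-above-one-of : ∀ {n} (t t' : Vec ℕ n) → Vec.sum t' ≤ Vec.sum t → t ≢ t' →
  ∃[ u ] suc (Vec.sum u) ≡ Vec.sum t × (∀ i → lookup t i ≤ lookup u i ⊎ lookup t' i ≤ lookup u i)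
∃-pred-sum-above-one-of [] [] _ t≢t' = ⊥-elim (t≢t' refl)
∃-pred-sum-above-one-of (a ∷ t) (a' ∷ t') Σt'≤Σt t≢t' with a' <? a
∃-pred-sum-above-one-of (zero  ∷ t) (a' ∷ t') _ _ | yes ()
∃-pred-sum-above-one-of (suc a ∷ t) (a' ∷ t') _ _ | yes (s≤s a'≤a) = (a ∷ t) , refl , above
  where
  above : ∀ i → lookup (suc a ∷ t) i ≤ lookup (a ∷ t) i ⊎ lookup (a' ∷ t') i ≤ lookup (a ∷ t) i
  above zero    = inj₂ a'≤a
  above (suc i) = inj₁ ≤-refl
... | no a'≮a with ≡-dec _≟_ t t'
...   | yes refl = ⊥-elim (t≢t' (cong (_∷ t) (≤-antisym (≮⇒≥ a'≮a) (+-cancelʳ-≤ (Vec.sum t) a' a Σt'≤Σt))))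
...   | no t≢t'
  with u , 1+Σu≡Σt , above ← ∃-pred-sum-above-one-of t t'
         (+-cancelˡ-≤ a' _ _ (≤-trans Σt'≤Σt (+-monoˡ-≤ (Vec.sum t) (≮⇒≥ a'≮a)))) t≢t' =
  (a ∷ u) , trans (sym (+-suc a (Vec.sum u))) (cong (_+_ a) 1+Σu≡Σt) ,
  λ { zero → inj₁ ≤-refl ; (suc i) → above i }

incrHead : ∀ {n} → Vec ℕ (suc n) → Vec ℕ (suc n)
incrHead (a ∷ t) = suc a ∷ t

compositions : (n k : ℕ) → List (Vec ℕ n)
compositions zero    zero    = [ [] ]
compositions zero    (suc k) = []
compositions (suc n) zero    = [ replicate (suc n) 0 ]
compositions (suc n) (suc k) = map incrHead (compositions (suc n) k) ++ map (0 ∷_) (compositions n (suc k))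

∈-compositions⇒sum≡ : ∀ n k {t} → t ∈ compositions n k → Vec.sum t ≡ k
∈-compositions⇒sum≡ zero    zero    (here refl) = refl
∈-compositions⇒sum≡ (suc n) zero    (here refl) = sum-replicate-0 n
  where
  sum-replicate-0 : ∀ n → Vec.sum (replicate n 0) ≡ 0
  sum-replicate-0 zero    = refl
  sum-replicate-0 (suc n) = sum-replicate-0 n
∈-compositions⇒sum≡ (suc n) (suc k) t∈ with ∈-++⁻ (map incrHead (compositions (suc n) k)) t∈
... | inj₁ t∈incr with (a ∷ t) , t∈' , refl ← ∈-map⁻ incrHead t∈incr =
  cong suc (∈-compositions⇒sum≡ (suc n) k t∈')
... | inj₂ t∈0∷ with t , t∈' , refl ← ∈-map⁻ (0 ∷_) t∈0∷ =
  ∈-compositions⇒sum≡ n (suc k) t∈'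

compositions-unique : ∀ n k → Unique (compositions n k)
compositions-unique zero    zero    = [] ∷ []
compositions-unique zero    (suc k) = []
compositions-unique (suc n) zero    = [] ∷ []
compositions-unique (suc n) (suc k) =
  Unique.++⁺ (Unique.map⁺ incrHead-injective (compositions-unique (suc n) k))
             (Unique.map⁺ ∷-injectiveʳ (compositions-unique n (suc k)))
             head-zero-or-positive
  where
  incrHead-injective : ∀ {t t' : Vec ℕ (suc n)} → incrHead t ≡ incrHead t' → t ≡ t'
  incrHead-injective {_ ∷ _} {_ ∷ _} refl = refl
  head-zero-or-positive :
    Disjoint (map incrHead (compositions (suc n) k)) (map (0 ∷_) (compositions n (suc k)))
  head-zero-or-positive (t∈incr , t∈0∷) with ∈-map⁻ incrHead t∈incr | ∈-map⁻ (0 ∷_) t∈0∷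
  ... | (_ ∷ _) , _ , refl | _ , _ , ()

-- Opened locally because C names the vertex set below.
module _ where
  open import Data.Nat.Combinatorics using (_C_; nCn≡1; nCk+nC[k+1]≡[n+1]C[k+1])

  length-compositions : ∀ n k → length (compositions (suc n) k) ≡ Tsize (suc n) k
  length-compositions n k = trans (length≡binomial n k) (cong (λ m → (m ∸ 1) C n) (sym (+-suc k n)))
    where
    length≡binomial : ∀ n k → length (compositions (suc n) k) ≡ (k + n) C n
    length≡binomial n zero    = sym (nCn≡1 n)
    length≡binomial n (suc k) = begin
      length (map incrHead (compositions (suc n) k) ++ map (0 ∷_) (compositions n (suc k)))
        ≡⟨ length-++ (map incrHead (compositions (suc n) k)) ⟩
      length (map incrHead (compositions (suc n) k)) + length (map (0 ∷_) (compositions n (suc k)))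
        ≡⟨ cong₂ _+_ (length-map incrHead (compositions (suc n) k))
                     (length-map (0 ∷_) (compositions n (suc k))) ⟩
      length (compositions (suc n) k) + length (compositions n (suc k))
        ≡⟨ cong (_+ length (compositions n (suc k))) (length≡binomial n k) ⟩
      (k + n) C n + length (compositions n (suc k))
        ≡⟨ pascal n ⟩
      (suc k + n) C n ∎
      where
      open ≡-Reasoning
      pascal : ∀ n → (k + n) C n + length (compositions n (suc k)) ≡ (suc k + n) C n
      pascal zero    = +-identityʳ _
      pascal (suc n) = begin
        (k + suc n) C suc n + length (compositions (suc n) (suc k))
          ≡⟨ cong₂ _+_ (cong (_C suc n) (+-suc k n)) (length≡binomial n (suc k)) ⟩
        suc (k + n) C suc n + (suc k + n) C n    ≡⟨ +-comm _ ((suc k + n) C n) ⟩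
        (suc k + n) C n + (suc k + n) C suc n    ≡⟨ nCk+nC[k+1]≡[n+1]C[k+1] (suc k + n) n ⟩
        suc (suc k + n) C suc n                  ≡⟨ cong (λ m → suc m C suc n) (sym (+-suc k n)) ⟩
        (suc k + suc n) C suc n                  ∎

length-cartesianProductWith : ∀ {A B C : Set} (f : A → B → C) xs ys →
                              length (cartesianProductWith f xs ys) ≡ length xs * length ys
length-cartesianProductWith f []       ys = refl
length-cartesianProductWith f (x ∷ xs) ys = begin
  length (map (f x) ys ++ cartesianProductWith f xs ys)
    ≡⟨ length-++ (map (f x) ys) ⟩
  length (map (f x) ys) + length (cartesianProductWith f xs ys)
    ≡⟨ cong₂ _+_ (length-map (f x) ys) (length-cartesianProductWith f xs ys) ⟩
  length ys + length xs * length ys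
    ∎
  where open ≡-Reasoning

grid : ∀ {n} → Vec ℕ n → List (Vec ℕ n)
grid []       = [ [] ]
grid (r ∷ rs) = cartesianProductWith _∷_ (upTo r) (grid rs)

∈-grid : ∀ {n} {p r : Vec ℕ n} → (∀ i → lookup p i < lookup r i) → p ∈ grid r
∈-grid {p = []}    {[]}     _   = here refl
∈-grid {p = a ∷ p} {r ∷ rs} p<r =
  Any.cartesianProductWith⁺ _∷_ (cong₂ _∷_) (∈-upTo⁺ (p<r zero)) (∈-grid {r = rs} (λ i → p<r (suc i)))

length-grid-^ : ∀ s {n} (e : Vec ℕ n) → length (grid (Vec.map (s ^_) e)) ≡ s ^ Vec.sum e
length-grid-^ s []      = refl
length-grid-^ s (a ∷ e) = begin
  length (cartesianProductWith _∷_ (upTo (s ^ a)) (grid (Vec.map (s ^_) e)))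
    ≡⟨ length-cartesianProductWith _∷_ (upTo (s ^ a)) _ ⟩
  length (upTo (s ^ a)) * length (grid (Vec.map (s ^_) e))
    ≡⟨ cong₂ _*_ (length-upTo (s ^ a)) (length-grid-^ s e) ⟩
  s ^ a * s ^ Vec.sum e
    ≡⟨ sym (^-distribˡ-+-* s a (Vec.sum e)) ⟩
  s ^ (a + Vec.sum e) ∎
  where open ≡-Reasoning

+a*+b+a≡+[a*b+a] : ∀ a b → + a ℤ.* + b ℤ.+ + a ≡ + (a * b + a)
+a*+b+a≡+[a*b+a] a b = trans (cong (ℤ._+ + a) (sym (ℤ.pos-* a b))) (sym (ℤ.pos-+ (a * b) a))

module Cells (s k : ℕ) .{{_ : NonZero s}} where

  s^l≡s^j*s^[l∸j] : ∀ {j l} → j ≤ l → s ^ l ≡ s ^ j * s ^ (l ∸ j)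
  s^l≡s^j*s^[l∸j] {j} {l} j≤l = trans (cong (s ^_) (sym (m+[n∸m]≡n j≤l))) (^-distribˡ-+-* s j (l ∸ j))

  cell : ℕ → ℚ → ℕ
  cell j x = (⌊ x ⌋ℕ / s ^ j) {{m^n≢0 s j}}

  cell-coarsen : ∀ {j l} x y → j ≤ l → cell j x ≡ cell j y → cell l x ≡ cell l y
  cell-coarsen {j} {l} x y j≤l eq = trans (split x) (trans (/-congˡ {o = s ^ (l ∸ j)} eq) (sym (split y)))
    where
    instance
      _ = m^n≢0 s j
      _ = m^n≢0 s l
      _ = m^n≢0 s (l ∸ j)
      _ = m*n≢0 (s ^ j) (s ^ (l ∸ j))
    split : ∀ z → cell l z ≡ cell j z / s ^ (l ∸ j)
    split z = trans (/-congʳ (s^l≡s^j*s^[l∸j] j≤l)) (sym (m/n/o≡m/[n*o] ⌊ z ⌋ℕ (s ^ j) (s ^ (l ∸ j))))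

  Cube : ∀ {d} → Point d → Set
  Cube = InHalfOpenCube (s ^ k)

  cell-interval : ∀ j {x} (z : ℤ) → 0ℚ ℚ.≤ x → z ≡ + cell j x →
    (ℤ→ℚ (+ (s ^ j) ℤ.* z) ℚ.≤ x) × (x ℚ.< ℤ→ℚ (+ (s ^ j) ℤ.* z ℤ.+ + (s ^ j)))
  cell-interval j {x} _ 0≤x refl =
    subst (ℚ._≤ x) (cong ℤ→ℚ (ℤ.pos-* (s ^ j) c)) (ℚ.≤-trans (ℕ→ℚ-mono-≤ s^j*c≤⌊x⌋) (⌊x⌋≤x 0≤x)) ,
    subst (x ℚ.<_) (cong ℤ→ℚ (sym (+a*+b+a≡+[a*b+a] (s ^ j) c)))
      (ℚ.<-≤-trans (x<⌊x⌋+1 0≤x) (ℕ→ℚ-mono-≤ ⌊x⌋<s^j*c+s^j))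
    where
    instance _ = m^n≢0 s j
    c = cell j x
    s^j*c≤⌊x⌋ : s ^ j * c ≤ ⌊ x ⌋ℕ
    s^j*c≤⌊x⌋ = ≤-trans (≤-reflexive (*-comm (s ^ j) c)) (m/n*n≤m ⌊ x ⌋ℕ (s ^ j))
    ⌊x⌋<s^j*c+s^j : ⌊ x ⌋ℕ < s ^ j * c + s ^ j
    ⌊x⌋<s^j*c+s^j = subst (⌊ x ⌋ℕ <_)
      (trans (+-comm (s ^ j) (c * s ^ j)) (cong (_+ s ^ j) (*-comm c (s ^ j)))) (m<[1+m/n]*n ⌊ x ⌋ℕ (s ^ j))

  cell<s^[k∸j] : ∀ j {x} → j ≤ k → 0ℚ ℚ.≤ x → x ℚ.< ℕ→ℚ (s ^ k) → cell j x < s ^ (k ∸ j)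
  cell<s^[k∸j] j {x} j≤k 0≤x x<s^k = m<n*o⇒m/o<n (subst (⌊ x ⌋ℕ <_) s^k≡s^[k∸j]*s^j ⌊x⌋<s^k)
    where
    instance _ = m^n≢0 s j
    ⌊x⌋<s^k : ⌊ x ⌋ℕ < s ^ k
    ⌊x⌋<s^k = ℕ→ℚ-cancel-< (ℚ.≤-<-trans (⌊x⌋≤x 0≤x) x<s^k)
    s^k≡s^[k∸j]*s^j : s ^ k ≡ s ^ (k ∸ j) * s ^ j
    s^k≡s^[k∸j]*s^j = trans (s^l≡s^j*s^[l∸j] j≤k) (*-comm (s ^ j) _)

  cell-interval-⊆-cube : ∀ j {x} (z : ℤ) → j ≤ k → 0ℚ ℚ.≤ x → x ℚ.< ℕ→ℚ (s ^ k) → z ≡ + cell j x →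
    (+ 0 ℤ.≤ + (s ^ j) ℤ.* z) × (+ (s ^ j) ℤ.* z ℤ.+ + (s ^ j) ℤ.≤ + (s ^ k))
  cell-interval-⊆-cube j {x} _ j≤k 0≤x x<s^k refl =
    subst (+ 0 ℤ.≤_) (ℤ.pos-* (s ^ j) c) (ℤ.+≤+ z≤n) ,
    subst (ℤ._≤ + (s ^ k)) (sym (+a*+b+a≡+[a*b+a] (s ^ j) c)) (ℤ.+≤+ (begin
      s ^ j * c + s ^ j       ≡⟨ trans (+-comm _ (s ^ j)) (sym (*-suc (s ^ j) c)) ⟩
      s ^ j * suc c           ≤⟨ *-monoʳ-≤ (s ^ j) (cell<s^[k∸j] j j≤k 0≤x x<s^k) ⟩
      s ^ j * s ^ (k ∸ j)     ≡⟨ sym (s^l≡s^j*s^[l∸j] j≤k) ⟩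
      s ^ k                   ∎))
    where
    open ≤-Reasoning
    c = cell j x

  -- x lies in the t-block B_t(cells t x).
  cells : ∀ {d} → Vec ℕ d → Point d → Vec ℕ d
  cells t x = tabulate (λ i → cell (lookup t i) (lookup x i))

  cells-≡⇒cell-≡ : ∀ {d} (t : Vec ℕ d) x y → cells t x ≡ cells t y →
                   ∀ i → cell (lookup t i) (lookup x i) ≡ cell (lookup t i) (lookup y i)
  cells-≡⇒cell-≡ t _ _ eq i =
    trans (sym (lookup∘tabulate _ i)) (trans (cong (λ c → lookup c i) eq) (lookup∘tabulate _ i))

  blockOf : ∀ {d ℓ} (t : Vec ℕ d) → Vec.sum t ≡ ℓ → ℓ ≤ k → (x : Point d) → Cube x → Block d s (s ^ k) ℓ
  blockOf t Σt≡ℓ ℓ≤k x x∈cube = block t (tabulate λ i → + cell (lookup t i) (lookup x i)) Σt≡ℓ λ i →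
    cell-interval-⊆-cube (lookup t i) _ (≤-trans (lookup≤sum t i) (subst (_≤ k) (sym Σt≡ℓ) ℓ≤k))
      (proj₁ (x∈cube i)) (proj₂ (x∈cube i)) (lookup∘tabulate _ i)

  SharedBlock : ∀ {d} → ℕ → Point d → Point d → Set
  SharedBlock {d} ℓ x y = Σ (Block d s (s ^ k) ℓ) λ B → InB B x × InB B y

  same-cells⇒SharedBlock : ∀ {d ℓ} (t : Vec ℕ d) → Vec.sum t ≡ ℓ → ℓ ≤ k → ∀ x y → Cube x → Cube y →
    (∀ i → cell (lookup t i) (lookup x i) ≡ cell (lookup t i) (lookup y i)) → SharedBlock ℓ x y
  same-cells⇒SharedBlock t Σt≡ℓ ℓ≤k x y x∈cube y∈cube same-cell =
    blockOf t Σt≡ℓ ℓ≤k x x∈cube , ∈block x x∈cube (λ _ → refl) , ∈block y y∈cube (λ i → sym (same-cell i))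
    where
    ∈block : ∀ z → Cube z → (∀ i → cell (lookup t i) (lookup z i) ≡ cell (lookup t i) (lookup x i)) →
             InB (blockOf t Σt≡ℓ ℓ≤k x x∈cube) z
    ∈block _ z∈cube z~x i =
      cell-interval (lookup t i) _ (proj₁ (z∈cube i)) (trans (lookup∘tabulate _ i) (cong +_ (sym (z~x i))))

  shared-blocks⇒shared-coarser-block : ∀ {d} {t t' : Vec ℕ d} → Vec.sum t ≡ k → Vec.sum t' ≡ k → t ≢ t' →
    ∀ x y → Cube x → Cube y → cells t x ≡ cells t y → cells t' x ≡ cells t' y → SharedBlock (k ∸ 1) x y
  shared-blocks⇒shared-coarser-block {t = t} {t'} Σt≡k Σt'≡k t≢t' x y x∈cube y∈cube same-t same-t'
    with u , 1+Σu≡Σt , above ← ∃-pred-sum-above-one-of t t' (≤-reflexive (trans Σt'≡k (sym Σt≡k))) t≢t' =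
    same-cells⇒SharedBlock u (cong (_∸ 1) (trans 1+Σu≡Σt Σt≡k)) (m∸n≤m k 1) x y x∈cube y∈cube same-u
    where
    same-u : ∀ i → cell (lookup u i) (lookup x i) ≡ cell (lookup u i) (lookup y i)
    same-u i with above i
    ... | inj₁ tᵢ≤uᵢ  = cell-coarsen (lookup x i) (lookup y i) tᵢ≤uᵢ  (cells-≡⇒cell-≡ t x y same-t i)
    ... | inj₂ t'ᵢ≤uᵢ = cell-coarsen (lookup x i) (lookup y i) t'ᵢ≤uᵢ (cells-≡⇒cell-≡ t' x y same-t' i)

  blockGrid : ∀ {d} → Vec ℕ d → List (Vec ℕ d)
  blockGrid t = grid (Vec.map (s ^_) (Vec.map (k ∸_) t))

  cells∈blockGrid : ∀ {d} (t : Vec ℕ d) → Vec.sum t ≤ k → ∀ x → Cube x → cells t x ∈ blockGrid t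
  cells∈blockGrid t Σt≤k x x∈cube = ∈-grid {r = Vec.map (s ^_) (Vec.map (k ∸_) t)} λ i →
    subst₂ _<_ (sym (lookup∘tabulate _ i))
    (sym (trans (lookup-map i (s ^_) (Vec.map (k ∸_) t)) (cong (s ^_) (lookup-map i (k ∸_) t))))
    (cell<s^[k∸j] (lookup t i) (≤-trans (lookup≤sum t i) Σt≤k) (proj₁ (x∈cube i)) (proj₂ (x∈cube i)))

  length-blockGrid : ∀ {n} (t : Vec ℕ (suc n)) → Vec.sum t ≡ k → length (blockGrid t) ≡ (s ^ k) ^ n
  length-blockGrid {n} t Σt≡k = begin
    length (blockGrid t)             ≡⟨ length-grid-^ s (Vec.map (k ∸_) t) ⟩
    s ^ Vec.sum (Vec.map (k ∸_) t)   ≡⟨ cong (s ^_) Σ[k∸t]≡n*k ⟩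
    s ^ (n * k)                      ≡⟨ cong (s ^_) (*-comm n k) ⟩
    s ^ (k * n)                      ≡⟨ sym (^-*-assoc s k n) ⟩
    (s ^ k) ^ n                      ∎
    where
    open ≡-Reasoning
    Σ[k∸t]≡n*k : Vec.sum (Vec.map (k ∸_) t) ≡ n * k
    Σ[k∸t]≡n*k = +-cancelʳ-≡ k _ _ (trans (subst (λ m → Vec.sum (Vec.map (k ∸_) t) + m ≡ suc n * k) Σt≡k
                   (sum[k∸t]+sum[t]≡n*k k t (≤-reflexive Σt≡k))) (+-comm k (n * k)))

module HighDegree
  {A : Set} (_≟_ : DecidableEquality A) (n k s : ℕ) .{{_ : NonZero s}}
  (Q : A → Point (suc n))
  (Q∈cube : ∀ v → InHalfOpenCube (s ^ k) (Q v))
  (sparse : ∀ (B : Block (suc n) s (s ^ k) (k ∸ 1)) v w → InB B (Q v) → InB B (Q w) → v ≡ w)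
  (C : List A) (C-unique : Unique C)
  where

  open Cells s k

  M : ℕ
  M = (s ^ k) ^ n

  Ts : List (Vec ℕ (suc n))
  Ts = compositions (suc n) k

  key : Vec ℕ (suc n) → A → Vec ℕ (suc n)
  key t v = cells t (Q v)

  sameBlock? : ∀ t v w → Dec (key t w ≡ key t v)
  sameBlock? t v w = ≡-dec ℕ._≟_ (key t w) (key t v)

  classSize : Vec ℕ (suc n) → A → ℕ
  classSize t v = fiberSize (≡-dec ℕ._≟_) (key t) C (key t v)

  neighboursAlong : Vec ℕ (suc n) → A → List A
  neighboursAlong t v = filter (λ w → ¬? (w ≟ v)) (filter (sameBlock? t v) C)

  neighbours : A → List A
  neighbours v = concatMap (λ t → neighboursAlong t v) Ts

  T*c²≤M*∑∑classSize : length Ts * (length C * length C) ≤ M * (∑[ v ∈ C ] ∑[ t ∈ Ts ] classSize t v)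
  T*c²≤M*∑∑classSize = begin
    length Ts * (c * c)                         ≡⟨ sym (∑-const Ts (c * c)) ⟩
    ∑[ t ∈ Ts ] c * c                           ≤⟨ ∑-mono-≤ Ts cauchy-schwarz ⟩
    ∑[ t ∈ Ts ] M * (∑[ v ∈ C ] classSize t v)  ≡⟨ sym (*-distribˡ-∑ M Ts _) ⟩
    M * (∑[ t ∈ Ts ] ∑[ v ∈ C ] classSize t v)  ≡⟨ cong (M *_) (∑-comm Ts C _) ⟩
    M * (∑[ v ∈ C ] ∑[ t ∈ Ts ] classSize t v)  ∎
    where
    open ≤-Reasoning
    c = length C
    cauchy-schwarz : ∀ {t} → t ∈ Ts → c * c ≤ M * (∑[ v ∈ C ] classSize t v)
    cauchy-schwarz {t} t∈Ts = subst (λ m → c * c ≤ m * (∑[ v ∈ C ] classSize t v)) (length-blockGrid t Σt≡k)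
      (length²≤length*∑fiberSize (≡-dec ℕ._≟_) (key t) (blockGrid t) C
        (λ {v} _ → cells∈blockGrid t (≤-reflexive Σt≡k) (Q v) (Q∈cube v)))
      where Σt≡k = ∈-compositions⇒sum≡ (suc n) k t∈Ts

  ∈-neighboursAlong⁻ : ∀ t v {w} → w ∈ neighboursAlong t v → w ∈ C × w ≢ v × key t w ≡ key t v
  ∈-neighboursAlong⁻ t v w∈
    with w∈filter , w≢v ← ∈-filter⁻ (λ w → ¬? (w ≟ v)) {xs = filter (sameBlock? t v) C} w∈
    with w∈C , same ← ∈-filter⁻ (sameBlock? t v) {xs = C} w∈filter = w∈C , w≢v , same

  classSize≤1+neighboursAlong : ∀ t v → classSize t v ≤ suc (length (neighboursAlong t v))
  classSize≤1+neighboursAlong t v =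
    length≤1+length-filter-≢ _≟_ v (Unique.filter⁺ (sameBlock? t v) C-unique)

  ∑classSize≤neighbours+T : ∀ v → ∑[ t ∈ Ts ] classSize t v ≤ length (neighbours v) + length Ts
  ∑classSize≤neighbours+T v = begin
    ∑[ t ∈ Ts ] classSize t v
      ≤⟨ ∑-mono-≤ Ts (λ {t} _ → classSize≤1+neighboursAlong t v) ⟩
    ∑[ t ∈ Ts ] (1 + length (neighboursAlong t v))
      ≡⟨ ∑-distrib-+ Ts (λ _ → 1) _ ⟩
    (∑[ t ∈ Ts ] 1) + (∑[ t ∈ Ts ] length (neighboursAlong t v))
      ≡⟨ cong₂ _+_ (∑-const Ts 1) (sym (length-concatMap _ Ts)) ⟩
    length Ts * 1 + length (neighbours v)
      ≡⟨ trans (cong (_+ length (neighbours v)) (*-identityʳ (length Ts))) (+-comm (length Ts) _) ⟩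
    length (neighbours v) + length Ts
      ∎
    where open ≤-Reasoning

  neighbours-unique : ∀ v → Unique (neighbours v)
  neighbours-unique v = concatMap⁺-Unique (λ t → neighboursAlong t v) {P = λ t → Vec.sum t ≡ k}
    (compositions-unique (suc n) k) (All.tabulate (∈-compositions⇒sum≡ (suc n) k))
    (λ t → Unique.filter⁺ _ (Unique.filter⁺ (sameBlock? t v) C-unique)) disjoint
    where
    disjoint : ∀ {t t'} → Vec.sum t ≡ k → Vec.sum t' ≡ k → t ≢ t' →
               Disjoint (neighboursAlong t v) (neighboursAlong t' v)
    disjoint {t} {t'} Σt≡k Σt'≡k t≢t' {w} (w∈ , w∈')
      with _ , w≢v , same ← ∈-neighboursAlong⁻ t v w∈
      with _ , _ , same' ← ∈-neighboursAlong⁻ t' v w∈'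
      with B , w∈B , v∈B ←
             shared-blocks⇒shared-coarser-block Σt≡k Σt'≡k t≢t' (Q w) (Q v) (Q∈cube w) (Q∈cube v) same same'
      = w≢v (sparse B w v w∈B v∈B)

  neighbours-adjacent : ∀ v → All (λ w → w ∈ C × w ≢ v × SharedBlock k (Q v) (Q w)) (neighbours v)
  neighbours-adjacent v = All.tabulate λ {w} w∈ → adjacent w∈
    where
    adjacent : ∀ {w} → w ∈ neighbours v → w ∈ C × w ≢ v × SharedBlock k (Q v) (Q w)
    adjacent {w} w∈
      with t , t∈Ts , w∈along ← ∈-concatMap⁻ _ w∈
      with w∈C , w≢v , same ← ∈-neighboursAlong⁻ t v w∈along =
      w∈C , w≢v , same-cells⇒SharedBlock t (∈-compositions⇒sum≡ (suc n) k t∈Ts) ≤-refl (Q v) (Q w)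
                    (Q∈cube v) (Q∈cube w) (cells-≡⇒cell-≡ t (Q v) (Q w) (sym same))

  totalClassSize : A → ℕ
  totalClassSize v = ∑[ t ∈ Ts ] classSize t v

  instance
    M≢0 : NonZero M
    M≢0 = m^n≢0 (s ^ k) n {{m^n≢0 s k}}

  T*c≤M*totalClassSize : ∀ {v} → 0 < length C → ∑ C totalClassSize ≤ length C * totalClassSize v →
                         length Ts * length C ≤ M * totalClassSize v
  T*c≤M*totalClassSize {v} 0<c ∑≤c*total[v] = *-cancelˡ-≤ c {{ℕ.>-nonZero 0<c}} (begin
    c * (T * c)                ≡⟨ x*[y*x]≡y*[x*x] c T ⟩
    T * (c * c)                ≤⟨ T*c²≤M*∑∑classSize ⟩
    M * ∑ C totalClassSize     ≤⟨ *-monoʳ-≤ M ∑≤c*total[v] ⟩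
    M * (c * totalClassSize v) ≡⟨ x*[y*z]≡y*[x*z] M c (totalClassSize v) ⟩
    c * (M * totalClassSize v) ∎)
    where
    open ≤-Reasoning
    c = length C
    T = length Ts
    x*[y*x]≡y*[x*x] : ∀ x y → x * (y * x) ≡ y * (x * x)
    x*[y*x]≡y*[x*x] = solve-∀
    x*[y*z]≡y*[x*z] : ∀ x y z → x * (y * z) ≡ y * (x * z)
    x*[y*z]≡y*[x*z] = solve-∀

  module _ (lam : ℚ) (2≤lam : ℕ→ℚ 2 ℚ.≤ lam) (λM≤c : lam ℚ.* ℕ→ℚ M ℚ.≤ ℕ→ℚ (length C)) where

    0<length[C] : 0 < length C
    0<length[C] = ≤-trans (ℕ.>-nonZero⁻¹ M) (≤-trans (m≤m+n M (M + 0)) (ℕ→ℚ-cancel-≤ (begin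
      ℕ→ℚ (2 * M)            ≡⟨ ℕ→ℚ-homo-* 2 M ⟩
      ℕ→ℚ 2 ℚ.* ℕ→ℚ M        ≤⟨ ℚ.*-monoʳ-≤-nonNeg (ℕ→ℚ M) {{ℚ.normalize-nonNeg M 1}} 2≤lam ⟩
      lam ℚ.* ℕ→ℚ M          ≤⟨ λM≤c ⟩
      ℕ→ℚ (length C)         ∎)))
      where open ℚ.≤-Reasoning

    degree-bound : ∀ v → ∑ C totalClassSize ≤ length C * totalClassSize v →
                   (lam ℚ.* ½) ℚ.* ℕ→ℚ (Tsize (suc n) k) ℚ.≤ ℕ→ℚ (length (neighbours v))
    degree-bound v ∑≤c*total[v] =
      subst (λ T → (lam ℚ.* ½) ℚ.* ℕ→ℚ T ℚ.≤ ℕ→ℚ D) (length-compositions n k)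
        (λt≤D+t⇒λ/2·t≤D T D 2≤lam (λM≤c⇒λt≤D+t lam M (length C) T D λM≤c T*c≤M*[D+T]))
      where
      T = length Ts
      D = length (neighbours v)
      T*c≤M*[D+T] : T * length C ≤ M * (D + T)
      T*c≤M*[D+T] = ≤-trans (T*c≤M*totalClassSize 0<length[C] ∑≤c*total[v])
                            (*-monoʳ-≤ M (∑classSize≤neighbours+T v))

    high-degree-vertex :
      ∃[ v ] (v ∈ C × ∃[ ws ] (Unique ws × All (λ w → w ∈ C × w ≢ v × SharedBlock k (Q v) (Q w)) ws ×
        (lam ℚ.* ½) ℚ.* ℕ→ℚ (Tsize (suc n) k) ℚ.≤ ℕ→ℚ (length ws)))
    high-degree-vertex =
      let v , v∈C , ∑≤c*total[v] = ∃-≥-average C totalClassSize 0<length[C] in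
      v , v∈C , neighbours v , neighbours-unique v , neighbours-adjacent v , degree-bound v ∑≤c*total[v]

sPar≢0 : ∀ d k → 0 < k → NonZero (sPar d k)
sPar≢0 d k 0<k = m*n≢0 16 (k ^ (2 * d)) {{_}} {{m^n≢0 k (2 * d) {{ℕ.>-nonZero 0<k}}}}

lemma4p1 : (d : ℕ) → 3 ≤ d →
    ∃[ K ] ((k : ℕ) → K ≤ k → 0 < k →
      (Q : Fin (NPar d k) → Point d) →
      (∀ i j → Q i ≡ Q j → i ≡ j) →
      (∀ i → InHalfOpenCube (mPar d k) (Q i)) →
      (∀ (B : Block d (sPar d k) (mPar d k) (k ∸ 1)) i j → InB B (Q i) → InB B (Q j) → i ≡ j) →
      (∀ (trs : List (Fin (NPar d k) × Fin (NPar d k) × Fin (NPar d k))) → Unique trs →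
        All (GoodTriple d k Q) trs →
        length trs ≤ 32 * Tsize d k ^ 3 * NPar d k) →
      (lam : ℚ) → ℕ→ℚ 2 ℚ.≤ lam →
      (C : List (Fin (NPar d k))) → Unique C →
      lam ℚ.* ℕ→ℚ (mPar d k ^ (d ∸ 1)) ℚ.≤ ℕ→ℚ (length C) →
      ∃[ v ] (v ∈ C × ∃[ ws ] (Unique ws ×
        All (λ w → w ∈ C × ¬ w ≡ v × CommonBlock2 d k (Q v) (Q w)) ws ×
        (lam ℚ.* ½) ℚ.* ℕ→ℚ (Tsize d k) ℚ.≤ ℕ→ℚ (length ws))))
lemma4p1 (suc n) _ = 1 , λ k _ 0<k Q _ Q∈cube sparse _ lam 2≤lam C C-unique λM≤c →
  HighDegree.high-degree-vertex F._≟_ n k (sPar (suc n) k) {{sPar≢0 (suc n) k 0<k}}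
    Q Q∈cube sparse C C-unique lam 2≤lam λM≤c
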